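{- Let $m\ge 3$, $n\ge 2$ and $2\le l\le\lceil n/2\rceil$. For every positive integer $k$, $$\chi_{B_l(m,n)}(2k+1)=\Big[\sum_{i=0}^{m-2}(-1)^i(2k)^{(m-2)-i}\Big]\,\chi_{B_l(m,n-1)}(2k+1).$$
   Context: A signed graph $(G,\sigma)$ is a finite graph $G$ with a sign function $\sigma:E(G)\to\{+1,-1\}$; its signature is the set of negative edges. A signed coloring in $2k+1$ colors is a map $c:V(G)\to\{ -k,\dots,k\}$; it is proper if $c(y)\neq\sigma(e)c(x)$ for every edge $e=xy$. The signed chromatic polynomial $\chi_{(G,\sigma)}(2k+1)$ is the number of proper signed colorings in $2k+1$ colors. For integers $m\ge 3$, $n\ge 1$, the Book graph $B(m,n)$ has vertex set $\{u,v\}\cup\{u_j^l:1\le l\le n,\,1\le j\le m-2\}$ and consists of the $n$ cycles $u\,u_1^l\cdots u_{m-2}^l\,v\,u$ sharing the edge $uv$. For $1\le l\le n$, $B_l(m,n)$ denotes $B(m,n)$ with signature $\{uu_1^1,uu_1^2,\dots,uu_1^l\}$. -}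

module Defs where

open import Data.Nat as ℕ using (ℕ; zero; suc; _∸_; _<ᵇ_)
open import Data.Integer as ℤ using (ℤ; +_; -_)
open import Data.Fin as Fin using (Fin; toℕ; _↑ʳ_; combine; inject₁; fromℕ)
open import Data.Bool using (Bool; true; false; if_then_else_)
open import Data.Product using (_×_; _,_)
open import Data.List as List using (List; []; _∷_; concatMap; upTo; length; filter; allFin)
open import Data.List.Relation.Unary.All using (All; all?)
open import Data.Vec as Vec using (Vec; lookup)
open import Relation.Nullary using (¬_; Dec; ¬?)
open import Relation.Binary.PropositionalEquality using (_≡_)

-- A signed graph on vertex set Fin N: list of edges (x , y , negative?)
-- where the Bool is true iff the edge is negative (lies in the signature).
SignedEdges : ℕ → Set
SignedEdges N = List (Fin N × Fin N × Bool)

sgn : Bool → ℤ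
sgn true  = - (+ 1)
sgn false = + 1

colours : ℕ → List ℤ
colours k = List.map (λ i → + i ℤ.- + k) (upTo (suc (2 ℕ.* k)))

-- all maps Fin N → colours, represented as vectors
allVecs : {A : Set} (N : ℕ) → List A → List (Vec A N)
allVecs zero    xs = Vec.[] ∷ []
allVecs (suc N) xs = concatMap (λ a → List.map (a Vec.∷_) (allVecs N xs)) xs

ProperEdge : {N : ℕ} → Vec ℤ N → Fin N × Fin N × Bool → Set
ProperEdge c (x , y , s) = ¬ (lookup c y ≡ sgn s ℤ.* lookup c x)

properEdge? : {N : ℕ} (c : Vec ℤ N) (e : Fin N × Fin N × Bool) → Dec (ProperEdge c e)
properEdge? c (x , y , s) = ¬? (lookup c y ℤ.≟ sgn s ℤ.* lookup c x)

Proper : {N : ℕ} → SignedEdges N → Vec ℤ N → Set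
Proper E c = All (ProperEdge c) E

-- signed chromatic polynomial evaluated at 2k+1:
-- number of proper signed colourings c : V → {-k,…,k}
signedChi : (N : ℕ) → SignedEdges N → ℕ → ℕ
signedChi N E k = length (filter (λ c → all? (properEdge? c) E) (allVecs N (colours k)))

-- Book graph B(m,n), m ≥ 3, with pages of length p = m - 2 = suc (m ∸ 3).
-- Vertices: u = 0, v = 1, u_j^l = 2 + combine l j  (l : Fin n, j : Fin p).
bookN : ℕ → ℕ → ℕ
bookN m n = 2 ℕ.+ n ℕ.* suc (m ∸ 3)

bu : (m n : ℕ) → Fin (bookN m n)
bu m n = Fin.zero

bv : (m n : ℕ) → Fin (bookN m n)
bv m n = Fin.suc Fin.zero

binner : (m n : ℕ) → Fin n → Fin (suc (m ∸ 3)) → Fin (bookN m n)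
binner m n l j = 2 ↑ʳ combine l j

-- B_L(m,n): signature {u u_1^1, …, u u_1^L}; page l (0-based index) is
-- negative on u u_1 iff toℕ l < L.
pageEdges : (m n L : ℕ) → Fin n → SignedEdges (bookN m n)
pageEdges m n L l =
  (bu m n , binner m n l Fin.zero , (toℕ l <ᵇ L))
  ∷ (binner m n l (fromℕ (m ∸ 3)) , bv m n , false)
  ∷ List.map (λ (j : Fin (m ∸ 3)) → (binner m n l (inject₁ j) , binner m n l (Fin.suc j) , false)) (allFin (m ∸ 3))

bookEdges : (m n L : ℕ) → SignedEdges (bookN m n)
bookEdges m n L = (bu m n , bv m n , false) ∷ concatMap (pageEdges m n L) (allFin n)

chiBook : (m n L k : ℕ) → ℕ
chiBook m n L k = signedChi (bookN m n) (bookEdges m n L) k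

altSum : (m k : ℕ) → ℤ
altSum m k = List.foldr ℤ._+_ (+ 0) (List.map (λ i → ((- (+ 1)) ℤ.^ i) ℤ.* ((+ (2 ℕ.* k)) ℤ.^ ((m ∸ 2) ∸ i))) (upTo (suc (m ∸ 2))))

module Submission where

-- Write p = m - 2 for the number of inner vertices of a page and q = 2k + 1
-- for the number of colours.  From 2 ≤ l ≤ ⌈n/2⌉ we get l ≤ n - 1, so the
-- last page of B_l(m,n) carries only positive edges.  The vertices of
-- B(m,n) are those of B(m,n-1) followed by the inner vertices of the last
-- page, so a colouring of B(m,n) is a pair (x , w); it is proper iff x is a
-- proper colouring of B_l(m,n-1) and w properly colours the inner vertices
-- of a positive path whose ends carry the colours x(u) ≠ x(v).  With
-- q = c + 2 colours the number of such w is D c p, where D and E count the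
-- colourings of a path with differently / equally coloured ends; they obey
-- D (t+1) = E t + c·D t and E (t+1) = (c+1)·D t.  Hence
-- χ_{B_l(m,n)} = χ_{B_l(m,n-1)} · D c p, and solving the recurrence gives
-- D c t = Σ_{i=0}^{t} (-1)^i (c+1)^{t-i}, the bracket of the theorem.

module Counting where

  import Data.Nat.Properties as ℕₚ
  open import Algebra.Properties.CommutativeSemigroup ℕₚ.+-commutativeSemigroup using (interchange)
  open import Data.Empty using (⊥-elim)
  open import Data.Fin as Fin using ()
  open import Data.Integer using (ℤ; _≟_)
  open import Data.List as List using (List; []; _∷_; _++_; length; filter; concatMap)
  open import Data.List.Membership.Propositional using (_∈_)
  open import Data.List.Relation.Unary.All as All using (All; []; _∷_)
  import Data.List.Relation.Unary.All.Properties as Allₚ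
  open import Data.List.Relation.Unary.Any using (here; there)
  open import Data.List.Relation.Unary.AllPairs using (_∷_)
  open import Data.List.Relation.Unary.Unique.Propositional using (Unique)
  open import Data.Nat using (ℕ; zero; suc; _+_; _*_)
  open import Data.Product using (_×_)
  open import Data.Vec as Vec using (Vec; lookup)
  open import Data.Vec.Relation.Binary.Equality.Cast using (cast-is-id)
  open import Function using (_∘_; id)
  open import Relation.Binary.PropositionalEquality
  open import Relation.Nullary using (¬_; Dec; yes; no; ¬?)
  open import Relation.Nullary.Decidable using (_×-dec_)
  open import Relation.Unary using (Decidable)
  open import Defs using (allVecs)

  ∑ : {A : Set} → List A → (A → ℕ) → ℕ
  ∑ []       f = 0
  ∑ (x ∷ xs) f = f x + ∑ xs f

  𝟙 : {P : Set} → Dec P → ℕ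
  𝟙 (yes _) = 1
  𝟙 (no _)  = 0

  select : {P : Set} → Dec P → ℕ → ℕ → ℕ
  select (yes _) e f = e
  select (no _)  e f = f

  length-filter : {A : Set} {P : A → Set} (P? : Decidable P) (xs : List A) →
    length (filter P? xs) ≡ ∑ xs (λ x → 𝟙 (P? x))
  length-filter P? [] = refl
  length-filter P? (x ∷ xs) with P? x
  ... | yes _ = cong suc (length-filter P? xs)
  ... | no _  = length-filter P? xs

  ∑-cong : {A : Set} (xs : List A) {f g : A → ℕ} → (∀ x → f x ≡ g x) → ∑ xs f ≡ ∑ xs g
  ∑-cong []       e = refl
  ∑-cong (x ∷ xs) e = cong₂ _+_ (e x) (∑-cong xs e)

  ∑-congᴬ : {A : Set} {xs : List A} {f g : A → ℕ} → All (λ x → f x ≡ g x) xs → ∑ xs f ≡ ∑ xs g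
  ∑-congᴬ []       = refl
  ∑-congᴬ (e ∷ es) = cong₂ _+_ e (∑-congᴬ es)

  ∑-++ : {A : Set} (xs ys : List A) (f : A → ℕ) → ∑ (xs ++ ys) f ≡ ∑ xs f + ∑ ys f
  ∑-++ []       ys f = refl
  ∑-++ (x ∷ xs) ys f = trans (cong (_+_ (f x)) (∑-++ xs ys f)) (sym (ℕₚ.+-assoc (f x) _ _))

  ∑-map : {A B : Set} (g : A → B) (xs : List A) (f : B → ℕ) → ∑ (List.map g xs) f ≡ ∑ xs (f ∘ g)
  ∑-map g []       f = refl
  ∑-map g (x ∷ xs) f = cong (_+_ (f (g x))) (∑-map g xs f)

  ∑-concatMap : {A B : Set} (g : A → List B) (xs : List A) (f : B → ℕ) →
    ∑ (concatMap g xs) f ≡ ∑ xs (λ x → ∑ (g x) f)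
  ∑-concatMap g []       f = refl
  ∑-concatMap g (x ∷ xs) f =
    trans (∑-++ (g x) (concatMap g xs) f) (cong (_+_ (∑ (g x) f)) (∑-concatMap g xs f))

  ∑-*ˡ : {A : Set} (xs : List A) (c : ℕ) (f : A → ℕ) → ∑ xs (λ x → c * f x) ≡ c * ∑ xs f
  ∑-*ˡ []       c f = sym (ℕₚ.*-zeroʳ c)
  ∑-*ˡ (x ∷ xs) c f = trans (cong (_+_ (c * f x)) (∑-*ˡ xs c f)) (sym (ℕₚ.*-distribˡ-+ c (f x) _))

  ∑-*ʳ : {A : Set} (xs : List A) (c : ℕ) (f : A → ℕ) → ∑ xs (λ x → f x * c) ≡ ∑ xs f * c
  ∑-*ʳ xs c f = trans (∑-cong xs (λ x → ℕₚ.*-comm (f x) c)) (trans (∑-*ˡ xs c f) (ℕₚ.*-comm c _))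

  ∑-+ : {A : Set} (xs : List A) (f g : A → ℕ) → ∑ xs (λ x → f x + g x) ≡ ∑ xs f + ∑ xs g
  ∑-+ []       f g = refl
  ∑-+ (x ∷ xs) f g = trans (cong (_+_ (f x + g x)) (∑-+ xs f g)) (interchange (f x) (g x) (∑ xs f) (∑ xs g))

  ∑-allVecs-suc : {A : Set} (N : ℕ) (xs : List A) (f : Vec A (suc N) → ℕ) →
    ∑ (allVecs (suc N) xs) f ≡ ∑ xs (λ x → ∑ (allVecs N xs) (λ v → f (x Vec.∷ v)))
  ∑-allVecs-suc N xs f =
    trans (∑-concatMap _ xs f) (∑-cong xs (λ x → ∑-map (x Vec.∷_) (allVecs N xs) f))

  ∑-allVecs-++ : {A : Set} (a b : ℕ) (xs : List A) (f : Vec A (a + b) → ℕ) →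
    ∑ (allVecs (a + b) xs) f ≡ ∑ (allVecs a xs) (λ v → ∑ (allVecs b xs) (λ w → f (v Vec.++ w)))
  ∑-allVecs-++ zero    b xs f = sym (ℕₚ.+-identityʳ _)
  ∑-allVecs-++ (suc a) b xs f = trans (∑-allVecs-suc (a + b) xs f)
    (trans (∑-cong xs (λ x → ∑-allVecs-++ a b xs (λ u → f (x Vec.∷ u))))
           (sym (∑-allVecs-suc a xs _)))

  ∑-allVecs-cast : {A : Set} (a b N : ℕ) (e : a + b ≡ N) (xs : List A) (f : Vec A N → ℕ) →
    ∑ (allVecs N xs) f ≡ ∑ (allVecs a xs) (λ v → ∑ (allVecs b xs) (λ w → f (Vec.cast e (v Vec.++ w))))
  ∑-allVecs-cast a b .(a + b) refl xs f = trans (∑-allVecs-++ a b xs f)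
    (∑-cong (allVecs a xs) (λ v → ∑-cong (allVecs b xs)
      (λ w → cong f (sym (cast-is-id refl (v Vec.++ w))))))

  allVecs-entries : {A : Set} {Q : A → Set} (N : ℕ) (xs : List A) → All Q xs →
    All (λ v → ∀ i → Q (lookup v i)) (allVecs N xs)
  allVecs-entries zero    xs qs = (λ ()) ∷ []
  allVecs-entries (suc N) xs qs = Allₚ.concat⁺ (Allₚ.map⁺ (All.map consEntries qs))
    where
    consEntries : ∀ {x} → _ → All _ (List.map (x Vec.∷_) (allVecs N xs))
    consEntries qx = Allₚ.map⁺ (All.map (λ qv → λ { Fin.zero → qx ; (Fin.suc i) → qv i })
                                        (allVecs-entries N xs qs))

  𝟙-× : {P Q : Set} (p : Dec P) (q : Dec Q) → 𝟙 (p ×-dec q) ≡ 𝟙 p * 𝟙 q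
  𝟙-× (yes _) (yes _) = refl
  𝟙-× (yes _) (no _)  = refl
  𝟙-× (no _)  (yes _) = refl
  𝟙-× (no _)  (no _)  = refl

  𝟙-⇔ : {P Q : Set} (p : Dec P) (q : Dec Q) → (P → Q) → (Q → P) → 𝟙 p ≡ 𝟙 q
  𝟙-⇔ (yes _) (yes _) f g = refl
  𝟙-⇔ (yes x) (no y)  f g = ⊥-elim (y (f x))
  𝟙-⇔ (no x)  (yes y) f g = ⊥-elim (x (g y))
  𝟙-⇔ (no _)  (no _)  f g = refl

  𝟙-*-cong : {P : Set} (p : Dec P) {a b : ℕ} → (P → a ≡ b) → 𝟙 p * a ≡ 𝟙 p * b
  𝟙-*-cong (yes x) h = cong (1 *_) (h x)
  𝟙-*-cong (no _)  h = refl

  select-linear : {P : Set} (p : Dec P) (e f : ℕ) → select p e f ≡ 𝟙 p * e + 𝟙 (¬? p) * f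
  select-linear (yes _) e f = sym (trans (ℕₚ.+-identityʳ (e + 0)) (ℕₚ.+-identityʳ e))
  select-linear (no _)  e f = sym (ℕₚ.+-identityʳ f)

  select-no : {P : Set} → ¬ P → (p : Dec P) {e f : ℕ} → select p e f ≡ f
  select-no ¬P (yes x) = ⊥-elim (¬P x)
  select-no ¬P (no _)  = refl

  _≢?_ : (a b : ℤ) → Dec (¬ a ≡ b)
  a ≢? b = ¬? (a ≟ b)

  𝟙-≢?-sym : (a b : ℤ) → 𝟙 (a ≢? b) ≡ 𝟙 (b ≢? a)
  𝟙-≢?-sym a b = 𝟙-⇔ (a ≢? b) (b ≢? a) (λ h e → h (sym e)) (λ h e → h (sym e))

  ∑-pick-absent : (xs : List ℤ) (a : ℤ) (f : ℤ → ℕ) → All (λ x → ¬ x ≡ a) xs →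
    ∑ xs (λ x → 𝟙 (x ≟ a) * f x) ≡ 0
  ∑-pick-absent []       a f []       = refl
  ∑-pick-absent (x ∷ xs) a f (h ∷ hs) with x ≟ a
  ... | yes e = ⊥-elim (h e)
  ... | no _  = ∑-pick-absent xs a f hs

  ∑-pick : (xs : List ℤ) → Unique xs → (a : ℤ) → a ∈ xs → (f : ℤ → ℕ) →
    ∑ xs (λ x → 𝟙 (x ≟ a) * f x) ≡ f a
  ∑-pick (y ∷ ys) (y∉ys ∷ _) a (here refl) f with y ≟ y
  ... | no y≢y = ⊥-elim (y≢y refl)
  ... | yes _ = trans (cong₂ _+_ (ℕₚ.+-identityʳ (f y))
                                (∑-pick-absent ys y f (All.map (λ h e → h (sym e)) y∉ys)))
                      (ℕₚ.+-identityʳ (f y))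
  ∑-pick (y ∷ ys) (y∉ys ∷ distinct) a (there a∈ys) f with y ≟ a
  ... | yes y≡a = ⊥-elim (All.lookup y∉ys a∈ys y≡a)
  ... | no _    = ∑-pick ys distinct a a∈ys f

  ∑-const-1 : {A : Set} (xs : List A) → ∑ xs (λ _ → 1) ≡ length xs
  ∑-const-1 []       = refl
  ∑-const-1 (x ∷ xs) = cong suc (∑-const-1 xs)

  -- Every x is exactly one of: equal to a; equal to b but not a; different from both.
  trichotomy : (x a b : ℤ) →
    𝟙 (x ≟ a) * 1 + (𝟙 (x ≟ b) * 𝟙 (x ≢? a) + 𝟙 (x ≢? a) * 𝟙 (x ≢? b)) ≡ 1
  trichotomy x a b with x ≟ a | x ≟ b
  ... | yes _ | yes _ = refl
  ... | yes _ | no _  = refl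
  ... | no _  | yes _ = refl
  ... | no _  | no _  = refl

  cancel-𝟙¬ : {P : Set} (p : Dec P) {s c : ℕ} → 𝟙 (¬? p) + s ≡ suc c → s ≡ 𝟙 p + c
  cancel-𝟙¬ (yes _) h = h
  cancel-𝟙¬ (no _)  h = ℕₚ.suc-injective h

  select-step : {P : Set} (p : Dec P) (c e d : ℕ) →
    𝟙 (¬? p) * e + (𝟙 p + c) * d ≡ select p (suc c * d) (e + c * d)
  select-step (yes _) c e d = refl
  select-step (no _)  c e d = cong (_+ c * d) (ℕₚ.+-identityʳ e)

  module DistinctColours {xs : List ℤ} (distinct : Unique xs) {c : ℕ} (size : length xs ≡ 2 + c) where

    members : All (_∈ xs) xs
    members = All.tabulate id

    avoid₂ : (a b : ℤ) → a ∈ xs → b ∈ xs →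
      ∑ xs (λ x → 𝟙 (x ≢? a) * 𝟙 (x ≢? b)) ≡ 𝟙 (a ≟ b) + c
    avoid₂ a b a∈xs b∈xs = cancel-𝟙¬ (a ≟ b) (ℕₚ.suc-injective (begin
      suc (𝟙 (a ≢? b) + avoiding)
        ≡⟨ cong₂ (λ s t → s + (t + avoiding)) (sym (∑-pick xs distinct a a∈xs (λ _ → 1)))
                                               (trans (𝟙-≢?-sym a b) (sym (∑-pick xs distinct b b∈xs _))) ⟩
      ∑ xs (λ x → 𝟙 (x ≟ a) * 1) + (∑ xs (λ x → 𝟙 (x ≟ b) * 𝟙 (x ≢? a)) + avoiding)
        ≡⟨ cong (_+_ (∑ xs (λ x → 𝟙 (x ≟ a) * 1))) (sym (∑-+ xs _ _)) ⟩
      ∑ xs (λ x → 𝟙 (x ≟ a) * 1) + ∑ xs (λ x → 𝟙 (x ≟ b) * 𝟙 (x ≢? a) + 𝟙 (x ≢? a) * 𝟙 (x ≢? b))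
        ≡⟨ sym (∑-+ xs _ _) ⟩
      ∑ xs (λ x → 𝟙 (x ≟ a) * 1 + (𝟙 (x ≟ b) * 𝟙 (x ≢? a) + 𝟙 (x ≢? a) * 𝟙 (x ≢? b)))
        ≡⟨ ∑-cong xs (λ x → trichotomy x a b) ⟩
      ∑ xs (λ _ → 1)
        ≡⟨ ∑-const-1 xs ⟩
      length xs
        ≡⟨ size ⟩
      2 + c ∎))
      where
      open ≡-Reasoning
      avoiding : ℕ
      avoiding = ∑ xs (λ x → 𝟙 (x ≢? a) * 𝟙 (x ≢? b))

    ∑-avoid : (a b : ℤ) → a ∈ xs → b ∈ xs → (e d : ℕ) →
      ∑ xs (λ x → 𝟙 (x ≢? a) * select (x ≟ b) e d) ≡ 𝟙 (b ≢? a) * e + (𝟙 (a ≟ b) + c) * d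
    ∑-avoid a b a∈xs b∈xs e d = begin
      ∑ xs (λ x → 𝟙 (x ≢? a) * select (x ≟ b) e d)
        ≡⟨ ∑-cong xs (λ x → trans (cong (𝟙 (x ≢? a) *_) (select-linear (x ≟ b) e d))
                                  (distribute (𝟙 (x ≢? a)) (𝟙 (x ≟ b)) (𝟙 (x ≢? b)) e d)) ⟩
      ∑ xs (λ x → 𝟙 (x ≟ b) * (𝟙 (x ≢? a) * e) + 𝟙 (x ≢? a) * 𝟙 (x ≢? b) * d)
        ≡⟨ ∑-+ xs _ _ ⟩
      ∑ xs (λ x → 𝟙 (x ≟ b) * (𝟙 (x ≢? a) * e)) + ∑ xs (λ x → 𝟙 (x ≢? a) * 𝟙 (x ≢? b) * d)
        ≡⟨ cong₂ _+_ (∑-pick xs distinct b b∈xs (λ x → 𝟙 (x ≢? a) * e))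
                     (trans (∑-*ʳ xs d _) (cong (_* d) (avoid₂ a b a∈xs b∈xs))) ⟩
      𝟙 (b ≢? a) * e + (𝟙 (a ≟ b) + c) * d ∎
      where
      open ≡-Reasoning
      distribute : ∀ s t t' e d → s * (t * e + t' * d) ≡ t * (s * e) + s * t' * d
      distribute = solve-∀ where open import Data.Nat.Tactic.RingSolver

  -- Path a b w: the colouring w of the inner vertices of a path with all edges
  -- positive is proper, when the two end vertices carry the colours a and b.
  Path : {t : ℕ} → ℤ → ℤ → Vec ℤ t → Set
  Path a b Vec.[]      = ¬ b ≡ a
  Path a b (x Vec.∷ w) = ¬ x ≡ a × Path x b w

  path? : {t : ℕ} (a b : ℤ) (w : Vec ℤ t) → Dec (Path a b w)
  path? a b Vec.[]      = b ≢? a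
  path? a b (x Vec.∷ w) = x ≢? a ×-dec path? x b w

  -- With c + 2 colours, D c t (resp. E c t) is the number of proper colourings
  -- of t inner vertices of a positive path whose ends have different (resp.
  -- equal) colours.  The first inner vertex avoids the near end's colour: for D
  -- it takes the far end's colour (E c t ways to go on) or one of c others
  -- (D c t ways each); for E it takes one of c + 1 colours (D c t ways each).
  D E : ℕ → ℕ → ℕ
  D c zero    = 1
  D c (suc t) = E c t + c * D c t
  E c zero    = 0
  E c (suc t) = suc c * D c t

  module PathCount {xs : List ℤ} (distinct : Unique xs) {c : ℕ} (size : length xs ≡ 2 + c) where
    open DistinctColours distinct size

    pathCount : (t : ℕ) (a b : ℤ) → a ∈ xs → b ∈ xs →
      ∑ (allVecs t xs) (λ w → 𝟙 (path? a b w)) ≡ select (a ≟ b) (E c t) (D c t)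
    pathCount zero a b _ _ = trans (ℕₚ.+-identityʳ _) (trans (𝟙-≢?-sym b a) (ends (a ≟ b)))
      where
      ends : {P : Set} (p : Dec P) → 𝟙 (¬? p) ≡ select p 0 1
      ends (yes _) = refl
      ends (no _)  = refl
    pathCount (suc t) a b a∈xs b∈xs = begin
      ∑ (allVecs (suc t) xs) (λ w → 𝟙 (path? a b w))
        ≡⟨ ∑-allVecs-suc t xs _ ⟩
      ∑ xs (λ x → ∑ (allVecs t xs) (λ v → 𝟙 (path? a b (x Vec.∷ v))))
        ≡⟨ ∑-cong xs (λ x → trans (∑-cong (allVecs t xs) (λ v → 𝟙-× (x ≢? a) (path? x b v)))
                                  (∑-*ˡ (allVecs t xs) (𝟙 (x ≢? a)) _)) ⟩
      ∑ xs (λ x → 𝟙 (x ≢? a) * ∑ (allVecs t xs) (λ v → 𝟙 (path? x b v)))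
        ≡⟨ ∑-congᴬ (All.map (λ {x} x∈xs → cong (𝟙 (x ≢? a) *_) (pathCount t _ b x∈xs b∈xs)) members) ⟩
      ∑ xs (λ x → 𝟙 (x ≢? a) * select (x ≟ b) (E c t) (D c t))
        ≡⟨ ∑-avoid a b a∈xs b∈xs (E c t) (D c t) ⟩
      𝟙 (b ≢? a) * E c t + (𝟙 (a ≟ b) + c) * D c t
        ≡⟨ cong (λ s → s * E c t + (𝟙 (a ≟ b) + c) * D c t) (𝟙-≢?-sym b a) ⟩
      𝟙 (a ≢? b) * E c t + (𝟙 (a ≟ b) + c) * D c t
        ≡⟨ select-step (a ≟ b) c (E c t) (D c t) ⟩
      select (a ≟ b) (E c (suc t)) (D c (suc t)) ∎
      where open ≡-Reasoning

module AlternatingSums where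

  open import Data.Integer using (ℤ; +_; -1ℤ; 1ℤ; _+_; _-_; _*_; _^_)
  import Data.Integer.Properties as ℤₚ
  open import Data.Integer.Tactic.RingSolver using (solve-∀)
  open import Data.List using (applyUpTo; foldr)
  import Data.List.Properties as Listₚ
  import Data.Nat as ℕ
  open ℕ using (ℕ; zero; suc; _∸_)
  open import Data.Product using (_×_; _,_)
  open import Function using (_∘_; id)
  open import Relation.Binary.PropositionalEquality
  open import Defs using (altSum)
  open Counting using (D; E)

  ∑ℤ : (ℕ → ℤ) → ℕ → ℤ
  ∑ℤ f n = foldr _+_ (+ 0) (applyUpTo f n)

  ∑ℤ-cong : ∀ n {f g : ℕ → ℤ} → (∀ i → f i ≡ g i) → ∑ℤ f n ≡ ∑ℤ g n
  ∑ℤ-cong zero    e = refl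
  ∑ℤ-cong (suc n) e = cong₂ _+_ (e 0) (∑ℤ-cong n (e ∘ suc))

  ∑ℤ-*ˡ : ∀ n (a : ℤ) (f : ℕ → ℤ) → ∑ℤ (λ i → a * f i) n ≡ a * ∑ℤ f n
  ∑ℤ-*ˡ zero    a f = sym (ℤₚ.*-zeroʳ a)
  ∑ℤ-*ˡ (suc n) a f =
    trans (cong (_+_ (a * f 0)) (∑ℤ-*ˡ n a (f ∘ suc))) (sym (ℤₚ.*-distribˡ-+ a (f 0) _))

  alternating : ℤ → ℕ → ℤ
  alternating X t = ∑ℤ (λ i → -1ℤ ^ i * X ^ (t ∸ i)) (suc t)

  alternating-peel : ∀ X t → alternating X (suc t) ≡ 1ℤ * X ^ suc t + -1ℤ * alternating X t
  alternating-peel X t = cong (_+_ (1ℤ * X ^ suc t))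
    (trans (∑ℤ-cong (suc t) (λ i → ℤₚ.*-assoc -1ℤ (-1ℤ ^ i) (X ^ (t ∸ i))))
           (∑ℤ-*ˡ (suc t) -1ℤ (λ i → -1ℤ ^ i * X ^ (t ∸ i))))

  alternating-horner : ∀ X t → alternating X (suc t) ≡ X * alternating X t + -1ℤ ^ suc t
  alternating-horner X zero = trans (alternating-peel X 0) (base X)
    where
    base : ∀ Y → 1ℤ * (Y * 1ℤ) + -1ℤ * (1ℤ * 1ℤ + + 0) ≡ Y * (1ℤ * 1ℤ + + 0) + -1ℤ * 1ℤ
    base = solve-∀
  alternating-horner X (suc t) = begin
    alternating X (suc (suc t))
      ≡⟨ alternating-peel X (suc t) ⟩
    1ℤ * (X * X ^ suc t) + -1ℤ * alternating X (suc t)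
      ≡⟨ cong (λ z → 1ℤ * (X * X ^ suc t) + -1ℤ * z) (alternating-horner X t) ⟩
    1ℤ * (X * X ^ suc t) + -1ℤ * (X * alternating X t + σ)
      ≡⟨ regroup X (X ^ suc t) (alternating X t) σ ⟩
    X * (1ℤ * X ^ suc t + -1ℤ * alternating X t) + -1ℤ * σ
      ≡⟨ cong (λ z → X * z + -1ℤ * σ) (sym (alternating-peel X t)) ⟩
    X * alternating X (suc t) + -1ℤ ^ suc (suc t) ∎
    where
    open ≡-Reasoning
    σ : ℤ
    σ = -1ℤ ^ suc t
    regroup : ∀ Y P A s → 1ℤ * (Y * P) + -1ℤ * (Y * A + s) ≡ Y * (1ℤ * P + -1ℤ * A) + -1ℤ * s
    regroup = solve-∀

  altSum-alternating : ∀ t k → altSum (2 ℕ.+ t) k ≡ alternating (+ (2 ℕ.* k)) t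
  altSum-alternating t k = cong (foldr _+_ (+ 0))
    (Listₚ.map-applyUpTo id (λ i → -1ℤ ^ i * (+ (2 ℕ.* k)) ^ (t ∸ i)) (suc t))

  pathCount-closedForm : ∀ c t →
    (+ D c t ≡ alternating (+ suc c) t) × (+ E c t ≡ alternating (+ suc c) t - -1ℤ ^ t)
  pathCount-closedForm c zero    = refl , refl
  pathCount-closedForm c (suc t) with pathCount-closedForm c t
  ... | Dₜ , Eₜ =
    (begin
      + (E c t ℕ.+ c ℕ.* D c t)      ≡⟨ ℤₚ.pos-+ (E c t) (c ℕ.* D c t) ⟩
      + E c t + + (c ℕ.* D c t)      ≡⟨ cong₂ _+_ Eₜ (trans (ℤₚ.pos-* c (D c t)) (cong (+ c *_) Dₜ)) ⟩
      (A - σ) + + c * A              ≡⟨ collectD (+ c) A σ ⟩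
      + suc c * A + -1ℤ * σ          ≡⟨ sym (alternating-horner (+ suc c) t) ⟩
      alternating (+ suc c) (suc t) ∎) ,
    (begin
      + (suc c ℕ.* D c t)            ≡⟨ trans (ℤₚ.pos-* (suc c) (D c t)) (cong (+ suc c *_) Dₜ) ⟩
      + suc c * A                    ≡⟨ collectE (+ suc c * A) (-1ℤ * σ) ⟩
      (+ suc c * A + -1ℤ * σ) - -1ℤ * σ
                                     ≡⟨ cong (_- -1ℤ * σ) (sym (alternating-horner (+ suc c) t)) ⟩
      alternating (+ suc c) (suc t) - -1ℤ ^ suc t ∎)
    where
    open ≡-Reasoning
    A σ : ℤ
    A = alternating (+ suc c) t
    σ = -1ℤ ^ t
    collectD : ∀ y a s → (a - s) + y * a ≡ (1ℤ + y) * a + -1ℤ * s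
    collectD = solve-∀
    collectE : ∀ a s → a ≡ (a + s) - s
    collectE = solve-∀

module Books where

  import Data.Nat.Properties as ℕₚ
  open import Data.Bool using (Bool; false)
  open import Data.Fin as Fin using (Fin; toℕ; fromℕ; inject₁)
  import Data.Fin.Properties as Finₚ
  open import Data.Fin.Relation.Unary.Top using (view; ‵fromℕ; ‵inject₁)
  open import Data.Integer as ℤ using (ℤ; +_; 1ℤ; _≟_)
  import Data.Integer.Properties as ℤₚ
  open import Data.List as List using (List; length; upTo)
  import Data.List.Properties as Listₚ
  open import Data.List.Membership.Propositional using (_∈_)
  open import Data.List.Relation.Unary.All as All using (All; _∷_; all?)
  import Data.List.Relation.Unary.All.Properties as Allₚ
  open import Data.List.Relation.Unary.Unique.Propositional using (Unique)
  import Data.List.Relation.Unary.Unique.Propositional.Properties as Uniqueₚ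
  open import Data.Nat using (ℕ; zero; suc; _+_; _*_; _≤_; _<ᵇ_; _/_; z≤n; s≤s)
  open import Data.Nat.DivMod using (m/n*n≤m)
  open import Data.Product using (_×_; _,_)
  open import Data.Vec as Vec using (Vec; lookup)
  import Data.Vec.Properties as Vecₚ
  open import Function using (_∘_)
  open import Relation.Binary.PropositionalEquality
  open import Relation.Nullary using (¬_; Dec)
  open import Relation.Nullary.Decidable using (_×-dec_)
  open import Defs
  open Counting

  colours-length : ∀ k → length (colours k) ≡ suc (2 * k)
  colours-length k = trans (Listₚ.length-map _ (upTo (suc (2 * k)))) (Listₚ.length-upTo _)

  colours-distinct : ∀ k → Unique (colours k)
  colours-distinct k = Uniqueₚ.map⁺ shift-injective (Uniqueₚ.upTo⁺ _)
    where
    undo : ∀ (a b : ℤ) → a ≡ (a ℤ.- b) ℤ.+ b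
    undo = solve-∀ where open import Data.Integer.Tactic.RingSolver
    shift-injective : ∀ {i j} → + i ℤ.- + k ≡ + j ℤ.- + k → i ≡ j
    shift-injective {i} {j} h = ℤₚ.+-injective
      (trans (undo (+ i) (+ k)) (trans (cong (λ z → z ℤ.+ + k) h) (sym (undo (+ j) (+ k)))))

  -- PageProper r s a b f: all edges of a page with r + 1 inner vertices,
  -- coloured by f, are proper when u, v carry the colours a, b and s is the
  -- sign of the edge u u₁ (every other edge of a page is positive).
  record PageProper (r : ℕ) (s : Bool) (a b : ℤ) (f : Fin (suc r) → ℤ) : Set where
    constructor page
    field
      firstEdge : ¬ f Fin.zero ≡ sgn s ℤ.* a
      lastEdge  : ¬ b ≡ 1ℤ ℤ.* f (fromℕ r)
      innerEdge : (j : Fin r) → ¬ f (Fin.suc j) ≡ 1ℤ ℤ.* f (inject₁ j)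

  pageProper-cong : ∀ {r s a a' b b'} {f f' : Fin (suc r) → ℤ} →
    a ≡ a' → b ≡ b' → (∀ j → f j ≡ f' j) → PageProper r s a b f → PageProper r s a' b' f'
  pageProper-cong {r} refl refl e (page first last inner) = page
    (λ q → first (trans (e Fin.zero) q))
    (λ q → last (trans q (cong (1ℤ ℤ.*_) (sym (e (fromℕ r))))))
    (λ j q → inner j (trans (e (Fin.suc j)) (trans q (cong (1ℤ ℤ.*_) (sym (e (inject₁ j)))))))

  resign : ∀ {r s s' a b f} → s ≡ s' → PageProper r s a b f → PageProper r s' a b f
  resign refl proper = proper

  positive-proper→≢ : ∀ {y z : ℤ} → ¬ y ≡ 1ℤ ℤ.* z → ¬ y ≡ z
  positive-proper→≢ h e = h (trans e (sym (ℤₚ.*-identityˡ _)))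

  ≢→positive-proper : ∀ {y z : ℤ} → ¬ y ≡ z → ¬ y ≡ 1ℤ ℤ.* z
  ≢→positive-proper h e = h (trans e (ℤₚ.*-identityˡ _))

  positivePage→path : ∀ r {a b} (w : Vec ℤ (suc r)) → PageProper r false a b (lookup w) → Path a b w
  positivePage→path zero (x Vec.∷ Vec.[]) (page first last _) =
    positive-proper→≢ first , positive-proper→≢ last
  positivePage→path (suc r) (x Vec.∷ w) (page first last inner) =
    positive-proper→≢ first , positivePage→path r w (page (inner Fin.zero) last (inner ∘ Fin.suc))

  path→positivePage : ∀ r {a b} (w : Vec ℤ (suc r)) → Path a b w → PageProper r false a b (lookup w)
  path→positivePage zero (x Vec.∷ Vec.[]) (x≢a , b≢x) =
    page (≢→positive-proper x≢a) (≢→positive-proper b≢x) (λ ())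
  path→positivePage (suc r) (x Vec.∷ w) (x≢a , rest) with path→positivePage r w rest
  ... | page first last inner =
    page (≢→positive-proper x≢a) last (λ { Fin.zero → first ; (Fin.suc j) → inner j })

  module Book (r : ℕ) where

    m p : ℕ
    m = 3 + r
    p = suc r

    BookProper : (n L : ℕ) → Vec ℤ (bookN m n) → Set
    BookProper n L c =
      ¬ lookup c (bv m n) ≡ 1ℤ ℤ.* lookup c (bu m n) ×
      ((i : Fin n) → PageProper r (toℕ i <ᵇ L) (lookup c (bu m n)) (lookup c (bv m n))
                                               (λ j → lookup c (binner m n i j)))

    module _ {n : ℕ} (L : ℕ) (c : Vec ℤ (bookN m n)) where

      pageEdges→ : ∀ i → All (ProperEdge c) (pageEdges m n L i) →
        PageProper r (toℕ i <ᵇ L) (lookup c (bu m n)) (lookup c (bv m n)) (λ j → lookup c (binner m n i j))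
      pageEdges→ i (first ∷ last ∷ inner) = page first last (Allₚ.tabulate⁻ (Allₚ.map⁻ inner))

      pageEdges← : ∀ i → PageProper r (toℕ i <ᵇ L) (lookup c (bu m n)) (lookup c (bv m n))
                                     (λ j → lookup c (binner m n i j)) →
        All (ProperEdge c) (pageEdges m n L i)
      pageEdges← i (page first last inner) = first ∷ last ∷ Allₚ.map⁺ (Allₚ.tabulate⁺ inner)

      bookEdges→ : All (ProperEdge c) (bookEdges m n L) → BookProper n L c
      bookEdges→ (uv ∷ pages) = uv , λ i → pageEdges→ i (Allₚ.tabulate⁻ (Allₚ.map⁻ (Allₚ.concat⁻ pages)) i)

      bookEdges← : BookProper n L c → All (ProperEdge c) (bookEdges m n L)
      bookEdges← (uv , pages) = uv ∷ Allₚ.concat⁺ (Allₚ.map⁺ (Allₚ.tabulate⁺ (λ i → pageEdges← i (pages i))))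

    size-addPage : ∀ n → bookN m n + p ≡ bookN m (suc n)
    size-addPage n = cong (suc ∘ suc) (ℕₚ.+-comm (n * p) p)

    glue : ∀ n → Vec ℤ (bookN m n) → Vec ℤ p → Vec ℤ (bookN m (suc n))
    glue n x w = Vec.cast (size-addPage n) (x Vec.++ w)

    toℕ-binner : ∀ n (i : Fin n) (j : Fin p) → toℕ (binner m n i j) ≡ 2 + (p * toℕ i + toℕ j)
    toℕ-binner n i j = trans (Finₚ.toℕ-↑ʳ 2 (Fin.combine i j)) (cong (_+_ 2) (Finₚ.toℕ-combine i j))

    module AddPage (n L : ℕ) (L≤n : L ≤ n) (x : Vec ℤ (bookN m n)) (w : Vec ℤ p) where

      c : Vec ℤ (bookN m (suc n))
      c = glue n x w

      lookup-glueˡ : (i : Fin (bookN m (suc n))) (i' : Fin (bookN m n)) → toℕ i ≡ toℕ i' →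
        lookup c i ≡ lookup x i'
      lookup-glueˡ i i' h = trans (Vecₚ.lookup-cast₁ (size-addPage n) (x Vec.++ w) i)
        (trans (cong (lookup (x Vec.++ w))
                 (Finₚ.toℕ-injective (trans (Finₚ.toℕ-cast _ i) (trans h (sym (Finₚ.toℕ-↑ˡ i' p))))))
               (Vecₚ.lookup-++ˡ x w i'))

      lookup-glueʳ : (i : Fin (bookN m (suc n))) (j : Fin p) → toℕ i ≡ bookN m n + toℕ j →
        lookup c i ≡ lookup w j
      lookup-glueʳ i j h = trans (Vecₚ.lookup-cast₁ (size-addPage n) (x Vec.++ w) i)
        (trans (cong (lookup (x Vec.++ w))
                 (Finₚ.toℕ-injective (trans (Finₚ.toℕ-cast _ i) (trans h (sym (Finₚ.toℕ-↑ʳ (bookN m n) j))))))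
               (Vecₚ.lookup-++ʳ x w j))

      glue-u : lookup c (bu m (suc n)) ≡ lookup x (bu m n)
      glue-u = lookup-glueˡ _ _ refl

      glue-v : lookup c (bv m (suc n)) ≡ lookup x (bv m n)
      glue-v = lookup-glueˡ _ _ refl

      glue-old : ∀ i j → lookup c (binner m (suc n) (inject₁ i) j) ≡ lookup x (binner m n i j)
      glue-old i j = lookup-glueˡ _ _ (begin
        toℕ (binner m (suc n) (inject₁ i) j) ≡⟨ toℕ-binner (suc n) (inject₁ i) j ⟩
        2 + (p * toℕ (inject₁ i) + toℕ j)   ≡⟨ cong (λ z → 2 + (p * z + toℕ j)) (Finₚ.toℕ-inject₁ i) ⟩
        2 + (p * toℕ i + toℕ j)             ≡⟨ sym (toℕ-binner n i j) ⟩
        toℕ (binner m n i j) ∎)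
        where open ≡-Reasoning

      glue-last : ∀ j → lookup c (binner m (suc n) (fromℕ n) j) ≡ lookup w j
      glue-last j = lookup-glueʳ _ _ (begin
        toℕ (binner m (suc n) (fromℕ n) j)  ≡⟨ toℕ-binner (suc n) (fromℕ n) j ⟩
        2 + (p * toℕ (fromℕ n) + toℕ j)     ≡⟨ cong (λ z → 2 + (z + toℕ j)) (cong (p *_) (Finₚ.toℕ-fromℕ n)) ⟩
        2 + (p * n + toℕ j)                 ≡⟨ cong (λ z → 2 + (z + toℕ j)) (ℕₚ.*-comm p n) ⟩
        bookN m n + toℕ j ∎)
        where open ≡-Reasoning

      sign-old : (i : Fin n) → (toℕ (inject₁ i) <ᵇ L) ≡ (toℕ i <ᵇ L)
      sign-old i = cong (_<ᵇ L) (Finₚ.toℕ-inject₁ i)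

      sign-last : (toℕ (fromℕ n) <ᵇ L) ≡ false
      sign-last = trans (cong (_<ᵇ L) (Finₚ.toℕ-fromℕ n)) (≮ᵇ L≤n)
        where
        ≮ᵇ : ∀ {a b} → a ≤ b → (b <ᵇ a) ≡ false
        ≮ᵇ z≤n     = refl
        ≮ᵇ (s≤s h) = ≮ᵇ h

      addPage→ : BookProper (suc n) L c → BookProper n L x × Path (lookup x (bu m n)) (lookup x (bv m n)) w
      addPage→ (uv , pages) =
        (subst₂ (λ a b → ¬ b ≡ 1ℤ ℤ.* a) glue-u glue-v uv ,
         λ i → pageProper-cong glue-u glue-v (glue-old i)
                 (resign (sign-old i) (pages (inject₁ i)))) ,
        positivePage→path r w (pageProper-cong glue-u glue-v glue-last
                 (resign sign-last (pages (fromℕ n))))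

      addPage← : BookProper n L x × Path (lookup x (bu m n)) (lookup x (bv m n)) w → BookProper (suc n) L c
      addPage← ((uv , pages) , path) = subst₂ (λ a b → ¬ b ≡ 1ℤ ℤ.* a) (sym glue-u) (sym glue-v) uv , newPages
        where
        newPages : (i : Fin (suc n)) → PageProper r (toℕ i <ᵇ L) (lookup c (bu m (suc n))) (lookup c (bv m (suc n)))
                                                  (λ j → lookup c (binner m (suc n) i j))
        newPages i with view i
        ... | ‵fromℕ = resign (sym sign-last)
                        (pageProper-cong (sym glue-u) (sym glue-v) (sym ∘ glue-last) (path→positivePage r w path))
        ... | ‵inject₁ i' = resign (sym (sign-old i'))
                        (pageProper-cong (sym glue-u) (sym glue-v) (sym ∘ glue-old i') (pages i'))

      addPage-𝟙 : 𝟙 (all? (properEdge? c) (bookEdges m (suc n) L))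
                ≡ 𝟙 (all? (properEdge? x) (bookEdges m n L)) * 𝟙 (path? (lookup x (bu m n)) (lookup x (bv m n)) w)
      addPage-𝟙 = trans
        (𝟙-⇔ (all? (properEdge? c) (bookEdges m (suc n) L)) (all? (properEdge? x) (bookEdges m n L) ×-dec newPage?)
          (λ proper → let (old , new) = addPage→ (bookEdges→ L c proper) in bookEdges← L x old , new)
          (λ (old , new) → bookEdges← L c (addPage← (bookEdges→ L x old , new))))
        (𝟙-× (all? (properEdge? x) (bookEdges m n L)) newPage?)
        where
        newPage? : Dec (Path (lookup x (bu m n)) (lookup x (bv m n)) w)
        newPage? = path? (lookup x (bu m n)) (lookup x (bv m n)) w

  chiBook-addPage : (r n L k c : ℕ) → 2 * k ≡ suc c → L ≤ n →
    chiBook (3 + r) (suc n) L k ≡ chiBook (3 + r) n L k * D c (suc r)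
  chiBook-addPage r n L k c 2k≡1+c L≤n = begin
    chiBook m (suc n) L k
      ≡⟨ length-filter (proper? Eₙ₊₁) (allVecs (bookN m (suc n)) cols) ⟩
    ∑ (allVecs (bookN m (suc n)) cols) (λ y → 𝟙 (proper? Eₙ₊₁ y))
      ≡⟨ ∑-allVecs-cast (bookN m n) p (bookN m (suc n)) (size-addPage n) cols _ ⟩
    ∑ (allVecs (bookN m n) cols) (λ x → ∑ (allVecs p cols) (λ w → 𝟙 (proper? Eₙ₊₁ (glue n x w))))
      ≡⟨ ∑-cong (allVecs (bookN m n) cols) (λ x →
           trans (∑-cong (allVecs p cols) (λ w → AddPage.addPage-𝟙 n L L≤n x w))
                 (∑-*ˡ (allVecs p cols) (𝟙 (proper? Eₙ x)) _)) ⟩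
    ∑ (allVecs (bookN m n) cols) (λ x → 𝟙 (proper? Eₙ x) * ∑ (allVecs p cols) (λ w → 𝟙 (path? (u x) (v x) w)))
      ≡⟨ ∑-congᴬ (All.map (λ {x} entries → 𝟙-*-cong (proper? Eₙ x) (newPageCount x entries))
                          (allVecs-entries (bookN m n) cols members)) ⟩
    ∑ (allVecs (bookN m n) cols) (λ x → 𝟙 (proper? Eₙ x) * D c p)
      ≡⟨ ∑-*ʳ (allVecs (bookN m n) cols) (D c p) _ ⟩
    ∑ (allVecs (bookN m n) cols) (λ x → 𝟙 (proper? Eₙ x)) * D c p
      ≡⟨ cong (_* D c p) (sym (length-filter (proper? Eₙ) (allVecs (bookN m n) cols))) ⟩
    chiBook m n L k * D c p ∎
    where
    open ≡-Reasoning
    open Book r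

    cols : List ℤ
    cols = colours k

    size : length cols ≡ 2 + c
    size = trans (colours-length k) (cong suc 2k≡1+c)

    open DistinctColours (colours-distinct k) size using (members)
    open PathCount (colours-distinct k) size

    Eₙ : SignedEdges (bookN m n)
    Eₙ = bookEdges m n L

    Eₙ₊₁ : SignedEdges (bookN m (suc n))
    Eₙ₊₁ = bookEdges m (suc n) L

    proper? : ∀ {N} (edges : SignedEdges N) (y : Vec ℤ N) → Dec (Proper edges y)
    proper? edges y = all? (properEdge? y) edges

    u v : Vec ℤ (bookN m n) → ℤ
    u x = lookup x (bu m n)
    v x = lookup x (bv m n)

    -- For a proper x the colours x(u) ≠ x(v) differ, so the new page has D c p colourings.
    newPageCount : ∀ x → (∀ i → lookup x i ∈ cols) → Proper Eₙ x →
      ∑ (allVecs p cols) (λ w → 𝟙 (path? (u x) (v x) w)) ≡ D c p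
    newPageCount x entries (uv ∷ _) =
      trans (pathCount p (u x) (v x) (entries _) (entries _))
            (select-no (positive-proper→≢ uv ∘ sym) (u x ≟ v x))

  -- For n = n' + 1, the hypothesis 2 ≤ l ≤ ⌈n/2⌉ = ⌊(n+1)/2⌋ forces l ≤ n', so
  -- the last page of B_l(m,n) is positive.
  lastPage-positive : (n' l : ℕ) → 2 ≤ l → l ≤ (suc n' + 1) / 2 → l ≤ n'
  lastPage-positive n' l 2≤l l≤half = ℕₚ.+-cancelʳ-≤ 2 l n' (begin
    l + 2                      ≤⟨ ℕₚ.+-monoʳ-≤ l 2≤l ⟩
    l + l                      ≡⟨ cong (_+_ l) (sym (ℕₚ.+-identityʳ l)) ⟩
    2 * l                      ≡⟨ ℕₚ.*-comm 2 l ⟩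
    l * 2                      ≤⟨ ℕₚ.*-monoˡ-≤ 2 l≤half ⟩
    (suc n' + 1) / 2 * 2       ≤⟨ m/n*n≤m (suc n' + 1) 2 ⟩
    suc n' + 1                 ≡⟨ sym (ℕₚ.+-suc n' 1) ⟩
    n' + 2 ∎)
    where open ℕₚ.≤-Reasoning

open Counting using (D)
open AlternatingSums using (alternating; altSum-alternating; pathCount-closedForm)
open Books using (chiBook-addPage; lastPage-positive)
open import Defs
open import Data.Nat using (ℕ; _≤_; _+_; _/_; _∸_; zero; suc; s≤s)
import Data.Nat as ℕ
open import Data.Integer using (+_; _*_)
import Data.Integer.Properties as ℤₚ
open import Data.Product using (proj₁)
open import Relation.Binary.PropositionalEquality using (_≡_; refl; cong; sym; module ≡-Reasoning)

theorem6p9 : (m n l k : ℕ) → 3 ≤ m → 2 ≤ n → 2 ≤ l → l ≤ (n + 1) / 2 → 1 ≤ k →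
    + chiBook m n l k ≡ altSum m k * + chiBook m (n ∸ 1) l k
theorem6p9 (suc (suc (suc r))) (suc n') l (suc k') _ _ 2≤l l≤half _ = begin
  + chiBook m (suc n') l k
    ≡⟨ cong +_ (chiBook-addPage r n' l k c refl (lastPage-positive n' l 2≤l l≤half)) ⟩
  + (chiBook m n' l k ℕ.* D c (suc r))
    ≡⟨ ℤₚ.pos-* (chiBook m n' l k) (D c (suc r)) ⟩
  + chiBook m n' l k * + D c (suc r)
    ≡⟨ cong (+ chiBook m n' l k *_) (proj₁ (pathCount-closedForm c (suc r))) ⟩
  + chiBook m n' l k * alternating (+ (2 ℕ.* k)) (suc r)
    ≡⟨ cong (+ chiBook m n' l k *_) (sym (altSum-alternating (suc r) k)) ⟩
  + chiBook m n' l k * altSum m k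
    ≡⟨ ℤₚ.*-comm (+ chiBook m n' l k) (altSum m k) ⟩
  altSum m k * + chiBook m n' l k ∎
  where
  open ≡-Reasoning
  m k c : ℕ
  m = 3 + r
  k = suc k'
  c = ℕ.pred (2 ℕ.* k)
theorem6p9 (suc (suc (suc r))) zero l k _ () _ _ _
theorem6p9 (suc (suc (suc r))) (suc n') l zero _ _ _ _ ()
theorem6p9 (suc (suc zero)) n l k (s≤s (s≤s ())) _ _ _ _
theorem6p9 (suc zero) n l k (s≤s ()) _ _ _ _
theorem6p9 zero n l k () _ _ _ _
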